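{- Let $r\in\mathbb{N}$, let $a_1\in\mathbb{N}$ and $a_j\in\mathbb{N}_0$ for $2\le j\le r$, and put $\mathbf{s}=(\{2\}^{a_1},1,\{2\}^{a_2},1,\dots,\{2\}^{a_r},1)$. Then for every $n\in\mathbb{N}$, \[ H^\star_n(\mathbf{s})=\sum_{\mathbf{p}\in\Pi(2a_1+1,\,2a_2+1,\,\dots,\,2a_r+1)}2^{\ell(\mathbf{p})}\,\mathcal{H}_n(\mathbf{p}). \]
   Context: $\mathbb{N}=\{1,2,\dots\}$, $\mathbb{N}_0=\mathbb{N}\cup\{0\}$. For $\mathbf{s}=(s_1,\dots,s_\ell)$ with nonzero integer entries, $H_n(\mathbf{s})=\sum_{n\ge k_1>\cdots>k_\ell\ge1}\prod_{i=1}^\ell \frac{\operatorname{sgn}(s_i)^{k_i}}{k_i^{|s_i|}}$ and $H^\star_n(\mathbf{s})=\sum_{n\ge k_1\ge\cdots\ge k_\ell\ge1}\prod_{i=1}^\ell \frac{\operatorname{sgn}(s_i)^{k_i}}{k_i^{|s_i|}}$, with $H_n(\mathbf{s})=0$ if $n<\ell$ and $H_n(\emptyset)=H^\star_n(\emptyset)=1$ for $n\ge0$. $\{2\}^a$ denotes $a$ copies of $2$. For nonzero integers $a,b$, $a\oplus b=\operatorname{sgn}(a)b+\operatorname{sgn}(b)a$. For a sequence $(s_1,\dots,s_m)$ of nonzero integers, $\Pi(s_1,\dots,s_m)$ is the set of the $2^{m-1}$ indices $s_1\circ\cdots\circ s_m$ where each $\circ$ is independently either "," or $\oplus$ (entries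 joined by $\oplus$ merge into one component); $\ell(\mathbf{p})$ is the number of components of $\mathbf{p}$. For $\mathbf{p}=(p_1,\dots,p_m)$ of nonzero integers, \[\mathcal{H}_n(\mathbf{p})=\sum_{k=1}^n\frac{\operatorname{sgn}(p_1)^k}{k^{|p_1|}}\cdot\frac{\binom{n}{k}}{\binom{n+k}{k}}\cdot H_{k-1}(p_2,\dots,p_m).\] -}

module Defs where

open import Data.Nat as ℕ using (ℕ; zero; suc)
open import Data.Nat.Combinatorics using (_C_)
open import Data.Integer as ℤ using (ℤ; +_; -[1+_])
open import Data.Rational as ℚ using (ℚ; 0ℚ; 1ℚ)
open import Data.List using (List; []; _∷_; _++_; map; replicate; concatMap; length)

sgn : ℤ → ℤ
sgn (+ zero)  = + 0
sgn (+ suc _) = + 1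
sgn -[1+ _ ]  = -[1+ 0 ]

_⊕_ : ℤ → ℤ → ℤ
a ⊕ b = (sgn a ℤ.* b) ℤ.+ (sgn b ℤ.* a)

-- a / d as a rational; the d = 0 branch is never used (all denominators are ≥ 1)
frac : ℤ → ℕ → ℚ
frac a zero    = 0ℚ
frac a (suc d) = a ℚ./ suc d

term : ℤ → ℕ → ℚ
term s k = frac (sgn s ℤ.^ k) (k ℕ.^ ℤ.∣ s ∣)

sumTo : ℕ → (ℕ → ℚ) → ℚ
sumTo zero    f = 0ℚ
sumTo (suc n) f = sumTo n f ℚ.+ f (suc n)

sumList : List ℚ → ℚ
sumList []       = 0ℚ
sumList (x ∷ xs) = x ℚ.+ sumList xs

-- multiple harmonic sum H_n(s) : n ≥ k₁ > k₂ > ⋯ > k_ℓ ≥ 1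
H : ℕ → List ℤ → ℚ
H n []       = 1ℚ
H n (s ∷ ss) = sumTo n (λ k → term s k ℚ.* H (k ℕ.∸ 1) ss)

-- multiple harmonic star sum H⋆_n(s) : n ≥ k₁ ≥ k₂ ≥ ⋯ ≥ k_ℓ ≥ 1
H⋆ : ℕ → List ℤ → ℚ
H⋆ n []       = 1ℚ
H⋆ n (s ∷ ss) = sumTo n (λ k → term s k ℚ.* H⋆ k ss)

-- Π(s₁,…,s_m): all 2^{m-1} ways of inserting "," or ⊕ between consecutive entries
mergeHead : ℤ → List ℤ → List ℤ
mergeHead x []       = x ∷ []
mergeHead x (p ∷ ps) = (x ⊕ p) ∷ ps

Π : List ℤ → List (List ℤ)
Π []           = [] ∷ []
Π (x ∷ [])     = (x ∷ []) ∷ []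
Π (x ∷ y ∷ ys) = map (x ∷_) (Π (y ∷ ys)) ++ map (mergeHead x) (Π (y ∷ ys))

𝓗 : ℕ → List ℤ → ℚ
𝓗 n []       = 0ℚ   -- not used (p is nonempty)
𝓗 n (p ∷ ps) =
  sumTo n (λ k → term p k ℚ.* frac (+ (n C k)) ((n ℕ.+ k) C k) ℚ.* H (k ℕ.∸ 1) ps)

sIndex : List ℕ → List ℤ
sIndex = concatMap (λ a → replicate a (+ 2) ++ (+ 1 ∷ []))

oddIndex : List ℕ → List ℤ
oddIndex = map (λ a → + (2 ℕ.* a ℕ.+ 1))

rhs : ℕ → List ℕ → ℚ
rhs n as = sumList (map (λ p → (+ (2 ℕ.^ length p)) ℚ./ 1 ℚ.* 𝓗 n p) (Π (oddIndex as)))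

-- Write b(n,k) = C(n,k)/C(n+k,k), so that 𝓗_n(p₁,p₂,…) = Σ_k b(n,k) sgn(p₁)^k k^(-|p₁|) H_{k-1}(p₂,…).
-- Two ratio identities drive the proof:
--   b(n+1,k) = b(n,k) + k²/(n+1)² · b(n+1,k)   and   (N-k+1) b(N,k-1) = (N-k) b(N,k) + 2k b(N,k).
-- The first gives 𝓗_{n+1}(p+2,…) = 𝓗_n(p+2,…) + 𝓗_{n+1}(p,…)/(n+1)², mirroring the recursion of
-- H⋆ when a 2 is prepended to s. The second, by telescoping and summation by parts, gives
-- Σ_{k≤n} 1/k = 2𝓗_n(1) and Σ_{m≤n} 𝓗_m(p,…)/m = 2𝓗_n(1,p,…) + 𝓗_n(p+1,…), mirroring a prepended 1;
-- the two terms on the right are exactly the two ways Π treats the new leading 1, with weights 2^ℓ.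

module Submission where

open import Defs
open import Data.Nat as ℕ using (ℕ; zero; suc; _≤_; _<_; s≤s; z≤n)
import Data.Nat.Properties as ℕP
open import Data.Nat.Combinatorics using (_C_; k>n⇒nCk≡0)
open import Relation.Binary.PropositionalEquality

module BinomialCoefficients where
  open import Data.Nat
  open import Data.Nat.Properties
  open import Data.Nat.Combinatorics using (nCk+nC[k+1]≡[n+1]C[k+1]; nC1≡n)
  open import Data.Nat.Solver using (module +-*-Solver)
  open +-*-Solver using (solve; _:+_; _:*_; _:=_; con)
  open ≡-Reasoning

  [k+1]*[n+1]C[k+1]≡[n+1]*nCk : ∀ n k → suc k * (suc n C suc k) ≡ suc n * (n C k)
  [k+1]*[n+1]C[k+1]≡[n+1]*nCk zero    zero    = refl
  [k+1]*[n+1]C[k+1]≡[n+1]*nCk zero    (suc k) = *-zeroʳ (2 + k)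
  [k+1]*[n+1]C[k+1]≡[n+1]*nCk (suc n) zero    = trans (+-identityʳ _) (trans (nC1≡n (2 + n)) (sym (*-identityʳ (2 + n))))
  [k+1]*[n+1]C[k+1]≡[n+1]*nCk (suc n) (suc k) = begin
    (2 + k) * ((2 + n) C (2 + k))
      ≡⟨ cong ((2 + k) *_) (nCk+nC[k+1]≡[n+1]C[k+1] (suc n) (suc k)) ⟨
    (2 + k) * (x + y)
      ≡⟨ *-distribˡ-+ (2 + k) x y ⟩
    (x + (1 + k) * x) + (2 + k) * y
      ≡⟨ cong₂ (λ a b → (x + a) + b) ([k+1]*[n+1]C[k+1]≡[n+1]*nCk n k) ([k+1]*[n+1]C[k+1]≡[n+1]*nCk n (suc k)) ⟩
    (x + (1 + n) * (n C k)) + (1 + n) * (n C suc k)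
      ≡⟨ +-assoc x _ _ ⟩
    x + ((1 + n) * (n C k) + (1 + n) * (n C suc k))
      ≡⟨ cong (x +_) (*-distribˡ-+ (1 + n) (n C k) (n C suc k)) ⟨
    x + (1 + n) * (n C k + n C suc k)
      ≡⟨ cong (λ z → x + (1 + n) * z) (nCk+nC[k+1]≡[n+1]C[k+1] n k) ⟩
    (2 + n) * x
      ∎
    where
    x = suc n C suc k
    y = suc n C (2 + k)

  nCk>0 : ∀ n k → k ≤ n → 0 < n C k
  nCk>0 n       zero    _           = s≤s z≤n
  nCk>0 (suc n) (suc k) (s≤s k≤n) =
    subst (0 <_) (nCk+nC[k+1]≡[n+1]C[k+1] n k) (≤-trans (nCk>0 n k k≤n) (m≤m+n (n C k) (n C suc k)))

  [n+k]Ck>0 : ∀ n k → 0 < (n + k) C k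
  [n+k]Ck>0 n k = nCk>0 (n + k) k (m≤n+m k n)

  [n+1]*nCk≡[n+1]Ck*[n+1-k] : ∀ n k → k ≤ suc n → suc n * (n C k) ≡ (suc n C k) * (suc n ∸ k)
  [n+1]*nCk≡[n+1]Ck*[n+1-k] n k k≤1+n = +-cancelʳ-≡ (k * (suc n C k)) _ _ (begin
    suc n * (n C k) + k * (suc n C k)            ≡⟨ pascal-weighted k ⟨
    (suc n C k) * suc n                          ≡⟨ cong ((suc n C k) *_) (m∸n+n≡m k≤1+n) ⟨
    (suc n C k) * (suc n ∸ k + k)                ≡⟨ *-distribˡ-+ (suc n C k) (suc n ∸ k) k ⟩
    (suc n C k) * (suc n ∸ k) + (suc n C k) * k  ≡⟨ cong ((suc n C k) * (suc n ∸ k) +_) (*-comm (suc n C k) k) ⟩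
    (suc n C k) * (suc n ∸ k) + k * (suc n C k)  ∎)
    where
    pascal-weighted : ∀ k → (suc n C k) * suc n ≡ suc n * (n C k) + k * (suc n C k)
    pascal-weighted zero    = trans (*-identityˡ (suc n)) (sym (trans (+-identityʳ _) (*-identityʳ (suc n))))
    pascal-weighted (suc k) = begin
      (suc n C suc k) * suc n                  ≡⟨ cong (_* suc n) (nCk+nC[k+1]≡[n+1]C[k+1] n k) ⟨
      (n C k + n C suc k) * suc n              ≡⟨ *-distribʳ-+ (suc n) (n C k) (n C suc k) ⟩
      (n C k) * suc n + (n C suc k) * suc n    ≡⟨ cong₂ _+_ (*-comm (n C k) (suc n)) (*-comm (n C suc k) (suc n)) ⟩
      suc n * (n C k) + suc n * (n C suc k)    ≡⟨ +-comm (suc n * (n C k)) _ ⟩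
      suc n * (n C suc k) + suc n * (n C k)    ≡⟨ cong (suc n * (n C suc k) +_) ([k+1]*[n+1]C[k+1]≡[n+1]*nCk n k) ⟨
      suc n * (n C suc k) + suc k * (suc n C suc k) ∎

  nCk*[n∸k]≡[k+1]*nC[k+1] : ∀ n k → k < n → (n C k) * (n ∸ k) ≡ suc k * (n C suc k)
  nCk*[n∸k]≡[k+1]*nC[k+1] (suc n) k (s≤s k≤n) =
    trans (sym ([n+1]*nCk≡[n+1]Ck*[n+1-k] n k (m≤n⇒m≤1+n k≤n))) (sym ([k+1]*[n+1]C[k+1]≡[n+1]*nCk n k))

  [n+k+1]Ck*[n+1]≡[n+k]Ck*[n+k+1] : ∀ n k → ((suc n + k) C k) * suc n ≡ ((n + k) C k) * (suc n + k)
  [n+k+1]Ck*[n+1]≡[n+k]Ck*[n+k+1] n k = begin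
    (suc (n + k) C k) * suc n               ≡⟨ cong ((suc (n + k) C k) *_) (m+n∸n≡m (suc n) k) ⟨
    (suc (n + k) C k) * (suc (n + k) ∸ k)   ≡⟨ [n+1]*nCk≡[n+1]Ck*[n+1-k] (n + k) k (m≤n⇒m≤1+n (m≤n+m k n)) ⟨
    suc (n + k) * ((n + k) C k)             ≡⟨ *-comm (suc (n + k)) _ ⟩
    ((n + k) C k) * (suc n + k)             ∎

  -- Cleared-denominator forms of the two ratio identities for b(n,k) = C(n,k)/C(n+k,k).
  binomRatio-upper-ℕ : ∀ n k → k ≤ suc n →
    (suc n * suc n) * (n C k) * ((suc n + k) C k) ≡ ((suc n ∸ k) * (suc n + k)) * (suc n C k) * ((n + k) C k)
  binomRatio-upper-ℕ n k k≤1+n = begin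
    (N * N) * X * Q
      ≡⟨ solve 3 (λ N X Q → (N :* N) :* X :* Q := (N :* X) :* (Q :* N)) refl N X Q ⟩
    (N * X) * (Q * N)
      ≡⟨ cong₂ _*_ ([n+1]*nCk≡[n+1]Ck*[n+1-k] n k k≤1+n) ([n+k+1]Ck*[n+1]≡[n+k]Ck*[n+k+1] n k) ⟩
    (Y * (N ∸ k)) * (P * (N + k))
      ≡⟨ solve 4 (λ Y D P E → (Y :* D) :* (P :* E) := (D :* E) :* Y :* P) refl Y (N ∸ k) P (N + k) ⟩
    ((N ∸ k) * (N + k)) * Y * P
      ∎
    where
    N = suc n
    X = n C k
    Y = suc n C k
    P = (n + k) C k
    Q = (suc n + k) C k

  binomRatio-lower-ℕ : ∀ N i → i < N →
    (N ∸ i) * (N C i) * ((N + suc i) C suc i) ≡ (N + suc i) * (N C suc i) * ((N + i) C i)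
  binomRatio-lower-ℕ N i i<N = *-cancelʳ-≡ _ _ (suc i) (begin
    (N ∸ i) * X * Q * suc i
      ≡⟨ solve 4 (λ D X Q s → D :* X :* Q :* s := (X :* D) :* (s :* Q)) refl (N ∸ i) X Q (suc i) ⟩
    (X * (N ∸ i)) * (suc i * Q)
      ≡⟨ cong₂ _*_ (nCk*[n∸k]≡[k+1]*nC[k+1] N i i<N) absorb ⟩
    (suc i * Y) * ((N + suc i) * P)
      ≡⟨ solve 4 (λ s Y M P → (s :* Y) :* (M :* P) := M :* Y :* P :* s) refl (suc i) Y (N + suc i) P ⟩
    (N + suc i) * Y * P * suc i
      ∎)
    where
    X = N C i
    Y = N C suc i
    P = (N + i) C i
    Q = (N + suc i) C suc i
    absorb : suc i * Q ≡ (N + suc i) * P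
    absorb rewrite +-suc N i = [k+1]*[n+1]C[k+1]≡[n+1]*nCk (N + i) i

  m+n≡[m∸n]+2*n : ∀ m n → n ≤ m → m + n ≡ (m ∸ n) + 2 * n
  m+n≡[m∸n]+2*n m n n≤m = begin
    m + n                    ≡⟨ cong (_+ n) (m∸n+n≡m n≤m) ⟨
    (m ∸ n) + n + n          ≡⟨ solve 2 (λ d n → d :+ n :+ n := d :+ con 2 :* n) refl (m ∸ n) n ⟩
    (m ∸ n) + 2 * n          ∎

  [m∸n]*[m+n]+n*n≡m*m : ∀ m n → n ≤ m → (m ∸ n) * (m + n) + n * n ≡ m * m
  [m∸n]*[m+n]+n*n≡m*m m n n≤m = begin
    (m ∸ n) * (m + n) + n * n
      ≡⟨ cong (λ z → (m ∸ n) * (z + n) + n * n) (m∸n+n≡m n≤m) ⟨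
    (m ∸ n) * ((m ∸ n) + n + n) + n * n
      ≡⟨ solve 2 (λ d n → d :* (d :+ n :+ n) :+ n :* n := (d :+ n) :* (d :+ n)) refl (m ∸ n) n ⟩
    ((m ∸ n) + n) * ((m ∸ n) + n)
      ≡⟨ cong (λ z → z * z) (m∸n+n≡m n≤m) ⟩
    m * m
      ∎

open BinomialCoefficients
open import Data.Integer as ℤ using (ℤ; +_; +[1+_])
import Data.Integer.Properties as ℤP
open import Data.Rational as ℚ using (ℚ; 0ℚ; 1ℚ; _+_; _*_)
import Data.Rational.Properties as ℚP
open import Data.Rational.Unnormalised as ℚᵘ using (mkℚᵘ; *≡*)
import Data.Rational.Unnormalised.Properties as ℚᵘP
open import Data.List using (List; []; _∷_; _++_; map; length)
open import Data.List.Properties using (map-∘; map-++; map-cong)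
open import Data.Product using (_×_; _,_; map₁)
open import Function using (_∘_)
open import Algebra.Bundles using (CommutativeMonoid)
import Algebra.Properties.CommutativeSemigroup as CommutativeSemigroupProperties
import Data.Rational.Solver as ℚSolver
open ≡-Reasoning
open ℚSolver.+-*-Solver using (solve; _:+_; _:*_; _:=_)
module +-CS = CommutativeSemigroupProperties (CommutativeMonoid.commutativeSemigroup ℚP.+-0-commutativeMonoid)
module *-CS = CommutativeSemigroupProperties (CommutativeMonoid.commutativeSemigroup ℚP.*-1-commutativeMonoid)

-- Fractions and the terms sgn(s)^k / k^|s|

fromℚᵘ-homo-+ : ∀ p q → ℚ.fromℚᵘ (p ℚᵘ.+ q) ≡ ℚ.fromℚᵘ p + ℚ.fromℚᵘ q
fromℚᵘ-homo-+ p q = ℚP.toℚᵘ-injective (ℚᵘP.≃-trans (ℚP.toℚᵘ-fromℚᵘ (p ℚᵘ.+ q)) (ℚᵘP.≃-sym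
  (ℚᵘP.≃-trans (ℚP.toℚᵘ-homo-+ (ℚ.fromℚᵘ p) (ℚ.fromℚᵘ q)) (ℚᵘP.+-cong (ℚP.toℚᵘ-fromℚᵘ p) (ℚP.toℚᵘ-fromℚᵘ q)))))

fromℚᵘ-homo-* : ∀ p q → ℚ.fromℚᵘ (p ℚᵘ.* q) ≡ ℚ.fromℚᵘ p * ℚ.fromℚᵘ q
fromℚᵘ-homo-* p q = ℚP.toℚᵘ-injective (ℚᵘP.≃-trans (ℚP.toℚᵘ-fromℚᵘ (p ℚᵘ.* q)) (ℚᵘP.≃-sym
  (ℚᵘP.≃-trans (ℚP.toℚᵘ-homo-* (ℚ.fromℚᵘ p) (ℚ.fromℚᵘ q)) (ℚᵘP.*-cong (ℚP.toℚᵘ-fromℚᵘ p) (ℚP.toℚᵘ-fromℚᵘ q)))))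

fromℕ : ℕ → ℚ
fromℕ m = frac (+ m) 1

frac-cross : ∀ x y d e → 0 < d → 0 < e → x ℕ.* e ≡ y ℕ.* d → frac (+ x) d ≡ frac (+ y) e
frac-cross x y (suc d) (suc e) _ _ xe≡yd = ℚP.fromℚᵘ-cong {mkℚᵘ (+ x) d} {mkℚᵘ (+ y) e} (*≡* (begin
  + x ℤ.* + suc e    ≡⟨ ℤP.pos-* x (suc e) ⟨
  + (x ℕ.* suc e)    ≡⟨ cong +_ xe≡yd ⟩
  + (y ℕ.* suc d)    ≡⟨ ℤP.pos-* y (suc d) ⟩
  + y ℤ.* + suc d    ∎))

frac-* : ∀ x y d e → 0 < d → 0 < e → frac (+ x) d * frac (+ y) e ≡ frac (+ (x ℕ.* y)) (d ℕ.* e)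
frac-* x y (suc d) (suc e) _ _ = begin
  ℚ.fromℚᵘ (mkℚᵘ (+ x) d) * ℚ.fromℚᵘ (mkℚᵘ (+ y) e)   ≡⟨ fromℚᵘ-homo-* (mkℚᵘ (+ x) d) (mkℚᵘ (+ y) e) ⟨
  ℚ.fromℚᵘ (mkℚᵘ (+ x) d ℚᵘ.* mkℚᵘ (+ y) e)           ≡⟨ cong (λ z → ℚ.fromℚᵘ (mkℚᵘ z _)) (ℤP.pos-* x y) ⟨
  frac (+ (x ℕ.* y)) (suc d ℕ.* suc e)                 ∎

frac-0 : ∀ d → 0 < d → frac (+ 0) d ≡ 0ℚ
frac-0 d d>0 = frac-cross 0 0 d 1 d>0 (s≤s z≤n) refl

fromℕ-homo-* : ∀ m n → fromℕ (m ℕ.* n) ≡ fromℕ m * fromℕ n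
fromℕ-homo-* m n = sym (frac-* m n 1 1 (s≤s z≤n) (s≤s z≤n))

fromℕ-homo-+ : ∀ m n → fromℕ (m ℕ.+ n) ≡ fromℕ m + fromℕ n
fromℕ-homo-+ m n = begin
  ℚ.fromℚᵘ (mkℚᵘ (+ (m ℕ.+ n)) 0)
    ≡⟨ ℚP.fromℚᵘ-cong {mkℚᵘ (+ (m ℕ.+ n)) 0} {mkℚᵘ (+ m) 0 ℚᵘ.+ mkℚᵘ (+ n) 0} (*≡* (cong (ℤ._* + 1) eq)) ⟩
  ℚ.fromℚᵘ (mkℚᵘ (+ m) 0 ℚᵘ.+ mkℚᵘ (+ n) 0)
    ≡⟨ fromℚᵘ-homo-+ (mkℚᵘ (+ m) 0) (mkℚᵘ (+ n) 0) ⟩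
  ℚ.fromℚᵘ (mkℚᵘ (+ m) 0) + ℚ.fromℚᵘ (mkℚᵘ (+ n) 0)
    ∎
  where
  eq : + (m ℕ.+ n) ≡ + m ℤ.* + 1 ℤ.+ + n ℤ.* + 1
  eq = trans (ℤP.pos-+ m n) (sym (cong₂ ℤ._+_ (ℤP.*-identityʳ (+ m)) (ℤP.*-identityʳ (+ n))))

fromℕ-*-frac : ∀ m x d → 0 < d → fromℕ m * frac (+ x) d ≡ frac (+ (m ℕ.* x)) d
fromℕ-*-frac m x d d>0 = trans (frac-* m x 1 d (s≤s z≤n) d>0)
  (frac-cross _ _ (1 ℕ.* d) d (subst (0 <_) (sym (ℕP.*-identityˡ d)) d>0) d>0 (cong ((m ℕ.* x) ℕ.*_) (sym (ℕP.*-identityˡ d))))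

*-inverse-cancel : ∀ {t c x y z} → t * c ≡ 1ℚ → c * x ≡ c * y + z → x ≡ y + t * z
*-inverse-cancel {t} {c} {x} {y} {z} t*c≡1 eq = begin
  x                      ≡⟨ ℚP.*-identityˡ x ⟨
  1ℚ * x                 ≡⟨ cong (_* x) t*c≡1 ⟨
  t * c * x              ≡⟨ ℚP.*-assoc t c x ⟩
  t * (c * x)            ≡⟨ cong (t *_) eq ⟩
  t * (c * y + z)        ≡⟨ ℚP.*-distribˡ-+ t (c * y) z ⟩
  t * (c * y) + t * z    ≡⟨ cong (_+ t * z) (ℚP.*-assoc t c y) ⟨
  t * c * y + t * z      ≡⟨ cong (λ w → w * y + t * z) t*c≡1 ⟩
  1ℚ * y + t * z         ≡⟨ cong (_+ t * z) (ℚP.*-identityˡ y) ⟩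
  y + t * z              ∎

term-+[1+] : ∀ a k → term +[1+ a ] (suc k) ≡ frac (+ 1) (suc k ℕ.^ suc a)
term-+[1+] a k = cong (λ z → frac z (suc k ℕ.^ suc a)) (ℤP.^-zeroˡ (suc k))

term-* : ∀ a b k → term +[1+ a ] (suc k) * term +[1+ b ] (suc k) ≡ term (+ (suc a ℕ.+ suc b)) (suc k)
term-* a b k = begin
  term +[1+ a ] K * term +[1+ b ] K                   ≡⟨ cong₂ _*_ (term-+[1+] a k) (term-+[1+] b k) ⟩
  frac (+ 1) (K ℕ.^ suc a) * frac (+ 1) (K ℕ.^ suc b)  ≡⟨ frac-* 1 1 _ _ (ℕP.m^n>0 K (suc a)) (ℕP.m^n>0 K (suc b)) ⟩
  frac (+ 1) (K ℕ.^ suc a ℕ.* K ℕ.^ suc b)             ≡⟨ cong (frac (+ 1)) (ℕP.^-distribˡ-+-* K (suc a) (suc b)) ⟨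
  frac (+ 1) (K ℕ.^ (suc a ℕ.+ suc b))                 ≡⟨ term-+[1+] (a ℕ.+ suc b) k ⟨
  term (+ (suc a ℕ.+ suc b)) K                         ∎
  where K = suc k

term-inverse : ∀ a k → term +[1+ a ] (suc k) * fromℕ (suc k ℕ.^ suc a) ≡ 1ℚ
term-inverse a k = begin
  term +[1+ a ] K * fromℕ D
    ≡⟨ cong (_* fromℕ D) (term-+[1+] a k) ⟩
  frac (+ 1) D * frac (+ D) 1
    ≡⟨ frac-* 1 D D 1 (ℕP.m^n>0 K (suc a)) (s≤s z≤n) ⟩
  frac (+ (1 ℕ.* D)) (D ℕ.* 1)
    ≡⟨ frac-cross _ 1 _ 1 (subst (0 <_) (sym (ℕP.*-identityʳ D)) (ℕP.m^n>0 K (suc a))) (s≤s z≤n) eq ⟩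
  1ℚ
    ∎
  where
  K = suc k
  D = K ℕ.^ suc a
  eq : 1 ℕ.* D ℕ.* 1 ≡ 1 ℕ.* (D ℕ.* 1)
  eq = ℕP.*-assoc 1 D 1

term-1-inverse : ∀ k → term (+ 1) (suc k) * fromℕ (suc k) ≡ 1ℚ
term-1-inverse k = subst (λ d → term (+ 1) (suc k) * fromℕ d ≡ 1ℚ) (ℕP.*-identityʳ (suc k)) (term-inverse 0 k)

term-2-inverse : ∀ k → term (+ 2) (suc k) * fromℕ (suc k ℕ.* suc k) ≡ 1ℚ
term-2-inverse k = subst (λ d → term (+ 2) (suc k) * fromℕ (suc k ℕ.* d) ≡ 1ℚ) (ℕP.*-identityʳ (suc k)) (term-inverse 1 k)

term-1≡term-2*fromℕ : ∀ k → term (+ 1) (suc k) ≡ term (+ 2) (suc k) * fromℕ (suc k)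
term-1≡term-2*fromℕ k = begin
  u                      ≡⟨ ℚP.*-identityʳ u ⟨
  u * 1ℚ                 ≡⟨ cong (u *_) (term-1-inverse k) ⟨
  u * (u * fromℕ K)      ≡⟨ ℚP.*-assoc u u (fromℕ K) ⟨
  u * u * fromℕ K        ≡⟨ cong (_* fromℕ K) (term-* 0 0 k) ⟩
  term (+ 2) K * fromℕ K ∎
  where
  K = suc k
  u = term (+ 1) K

fromℕ-square-*-term-1 : ∀ k → fromℕ (suc k ℕ.* suc k) * term (+ 1) (suc k) ≡ fromℕ (suc k)
fromℕ-square-*-term-1 k = begin
  fromℕ (K ℕ.* K) * u          ≡⟨ cong (_* u) (fromℕ-homo-* K K) ⟩
  fromℕ K * fromℕ K * u        ≡⟨ *-CS.xy∙z≈x∙zy (fromℕ K) (fromℕ K) u ⟩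
  fromℕ K * (u * fromℕ K)      ≡⟨ cong (fromℕ K *_) (term-1-inverse k) ⟩
  fromℕ K * 1ℚ                 ≡⟨ ℚP.*-identityʳ (fromℕ K) ⟩
  fromℕ K                      ∎
  where
  K = suc k
  u = term (+ 1) K

term-shift : ∀ h k → fromℕ (suc k ℕ.* suc k) * term +[1+ 2 ℕ.+ h ] (suc k) ≡ term +[1+ h ] (suc k)
term-shift h k = begin
  fromℕ (K ℕ.* K) * term +[1+ 2 ℕ.+ h ] K
    ≡⟨ cong (fromℕ (K ℕ.* K) *_) (term-* 1 h k) ⟨
  fromℕ (K ℕ.* K) * (term (+ 2) K * term +[1+ h ] K)
    ≡⟨ *-CS.x∙yz≈yx∙z (fromℕ (K ℕ.* K)) (term (+ 2) K) (term +[1+ h ] K) ⟩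
  term (+ 2) K * fromℕ (K ℕ.* K) * term +[1+ h ] K
    ≡⟨ cong (_* term +[1+ h ] K) (term-2-inverse k) ⟩
  1ℚ * term +[1+ h ] K
    ≡⟨ ℚP.*-identityˡ (term +[1+ h ] K) ⟩
  term +[1+ h ] K
    ∎
  where K = suc k

-- Finite sums

sumTo-cong : ∀ n {f g : ℕ → ℚ} → (∀ {k} → 1 ≤ k → k ≤ n → f k ≡ g k) → sumTo n f ≡ sumTo n g
sumTo-cong zero    _    = refl
sumTo-cong (suc n) f≡g =
  cong₂ _+_ (sumTo-cong n (λ 1≤k k≤n → f≡g 1≤k (ℕP.m≤n⇒m≤1+n k≤n))) (f≡g (s≤s z≤n) ℕP.≤-refl)

sumTo-+ : ∀ n (f g : ℕ → ℚ) → sumTo n (λ k → f k + g k) ≡ sumTo n f + sumTo n g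
sumTo-+ zero    f g = refl
sumTo-+ (suc n) f g = trans (cong (_+ (f (suc n) + g (suc n))) (sumTo-+ n f g)) (+-CS.interchange (sumTo n f) (sumTo n g) (f (suc n)) (g (suc n)))

sumTo-* : ∀ n c (f : ℕ → ℚ) → sumTo n (λ k → c * f k) ≡ c * sumTo n f
sumTo-* zero    c f = sym (ℚP.*-zeroʳ c)
sumTo-* (suc n) c f = trans (cong (_+ c * f (suc n)) (sumTo-* n c f)) (sym (ℚP.*-distribˡ-+ c (sumTo n f) (f (suc n))))

sumTo-zero : ∀ n → sumTo n (λ _ → 0ℚ) ≡ 0ℚ
sumTo-zero zero    = refl
sumTo-zero (suc n) = trans (ℚP.+-identityʳ _) (sumTo-zero n)

sumTo-telescope : ∀ M (T d : ℕ → ℚ) → (∀ {i} → i < M → T i ≡ T (suc i) + d (suc i)) → T 0 ≡ T M + sumTo M d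
sumTo-telescope zero    T d _    = sym (ℚP.+-identityʳ (T 0))
sumTo-telescope (suc M) T d step = begin
  T 0                                    ≡⟨ sumTo-telescope M T d (λ i<M → step (ℕP.m<n⇒m<1+n i<M)) ⟩
  T M + sumTo M d                        ≡⟨ cong (_+ sumTo M d) (step (ℕP.n<1+n M)) ⟩
  T (suc M) + d (suc M) + sumTo M d      ≡⟨ +-CS.xy∙z≈x∙zy (T (suc M)) (d (suc M)) (sumTo M d) ⟩
  T (suc M) + (sumTo M d + d (suc M))    ∎

sumTo-by-parts : ∀ M (c T d : ℕ → ℚ) → (∀ {i} → i < M → T i ≡ T (suc i) + d (suc i)) →
  sumTo M (λ k → c k * T k) ≡ sumTo M (λ j → d j * sumTo (j ℕ.∸ 1) c) + sumTo M c * T M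
sumTo-by-parts zero    c T d _    = sym (trans (ℚP.+-identityˡ _) (ℚP.*-zeroˡ (T 0)))
sumTo-by-parts (suc M) c T d step = begin
  sumTo M (λ k → c k * T k) + c K * T K
    ≡⟨ cong (_+ c K * T K) (sumTo-by-parts M c T d (λ i<M → step (ℕP.m<n⇒m<1+n i<M))) ⟩
  D + S * T M + c K * T K
    ≡⟨ cong (λ x → D + S * x + c K * T K) (step (ℕP.n<1+n M)) ⟩
  D + S * (T K + d K) + c K * T K
    ≡⟨ solve 5 (λ D S t d c → D :+ S :* (t :+ d) :+ c :* t := (D :+ d :* S) :+ (S :+ c) :* t) refl D S (T K) (d K) (c K) ⟩
  (D + d K * S) + (S + c K) * T K
    ∎
  where
  K = suc M
  D = sumTo M (λ j → d j * sumTo (j ℕ.∸ 1) c)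
  S = sumTo M c

sumList-++ : ∀ (xs ys : List ℚ) → sumList (xs ++ ys) ≡ sumList xs + sumList ys
sumList-++ []       ys = sym (ℚP.+-identityˡ (sumList ys))
sumList-++ (x ∷ xs) ys = trans (cong (λ s → x + s) (sumList-++ xs ys)) (sym (ℚP.+-assoc x (sumList xs) (sumList ys)))

module _ {A : Set} where

  sumList-map-+ : ∀ (f g : A → ℚ) xs → sumList (map (λ x → f x + g x) xs) ≡ sumList (map f xs) + sumList (map g xs)
  sumList-map-+ f g []       = refl
  sumList-map-+ f g (x ∷ xs) = trans (cong (λ s → f x + g x + s) (sumList-map-+ f g xs))
    (+-CS.interchange (f x) (g x) (sumList (map f xs)) (sumList (map g xs)))

  sumList-map-* : ∀ c (f : A → ℚ) xs → sumList (map (λ x → c * f x) xs) ≡ c * sumList (map f xs)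
  sumList-map-* c f []       = sym (ℚP.*-zeroʳ c)
  sumList-map-* c f (x ∷ xs) = trans (cong (λ s → c * f x + s) (sumList-map-* c f xs))
    (sym (ℚP.*-distribˡ-+ c (f x) (sumList (map f xs))))

  sumList-map-zero : ∀ (f : A → ℚ) xs → (∀ x → f x ≡ 0ℚ) → sumList (map f xs) ≡ 0ℚ
  sumList-map-zero f []       _      = refl
  sumList-map-zero f (x ∷ xs) f≡0 = trans (cong₂ _+_ (f≡0 x) (sumList-map-zero f xs f≡0)) (ℚP.+-identityˡ 0ℚ)

  sumTo-sumList : ∀ n (g : ℕ → A → ℚ) xs →
    sumTo n (λ m → sumList (map (g m) xs)) ≡ sumList (map (λ x → sumTo n (λ m → g m x)) xs)
  sumTo-sumList n g []       = sumTo-zero n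
  sumTo-sumList n g (x ∷ xs) = trans (sumTo-+ n (λ m → g m x) (λ m → sumList (map (g m) xs)))
    (cong (λ s → sumTo n (λ m → g m x) + s) (sumTo-sumList n g xs))

-- The ratios b(n,k) = C(n,k)/C(n+k,k)

binomRatio : ℕ → ℕ → ℚ
binomRatio n k = frac (+ (n C k)) ((n ℕ.+ k) C k)

binomRatio-cross : ∀ α n k β m j → α ℕ.* (n C k) ℕ.* ((m ℕ.+ j) C j) ≡ β ℕ.* (m C j) ℕ.* ((n ℕ.+ k) C k) →
  fromℕ α * binomRatio n k ≡ fromℕ β * binomRatio m j
binomRatio-cross α n k β m j eq = begin
  fromℕ α * binomRatio n k                     ≡⟨ fromℕ-*-frac α (n C k) _ ([n+k]Ck>0 n k) ⟩
  frac (+ (α ℕ.* (n C k))) ((n ℕ.+ k) C k)     ≡⟨ frac-cross _ _ _ _ ([n+k]Ck>0 n k) ([n+k]Ck>0 m j) eq ⟩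
  frac (+ (β ℕ.* (m C j))) ((m ℕ.+ j) C j)     ≡⟨ fromℕ-*-frac β (m C j) _ ([n+k]Ck>0 m j) ⟨
  fromℕ β * binomRatio m j                     ∎

binomRatio-beyond : ∀ n → binomRatio n (suc n) ≡ 0ℚ
binomRatio-beyond n = trans (cong (λ x → frac (+ x) ((n ℕ.+ suc n) C suc n)) (k>n⇒nCk≡0 (ℕP.n<1+n n))) (frac-0 _ ([n+k]Ck>0 n (suc n)))

binomRatio-suc : ∀ n k → k ≤ suc n →
  binomRatio (suc n) k ≡ binomRatio n k + term (+ 2) (suc n) * (fromℕ (k ℕ.* k) * binomRatio (suc n) k)
binomRatio-suc n k k≤N = *-inverse-cancel {term (+ 2) N} {fromℕ (N ℕ.* N)} (term-2-inverse n) (begin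
  fromℕ (N ℕ.* N) * b                                   ≡⟨ cong (λ m → fromℕ m * b) ([m∸n]*[m+n]+n*n≡m*m N k k≤N) ⟨
  fromℕ (D ℕ.+ k ℕ.* k) * b                             ≡⟨ cong (_* b) (fromℕ-homo-+ D (k ℕ.* k)) ⟩
  (fromℕ D + fromℕ (k ℕ.* k)) * b                       ≡⟨ ℚP.*-distribʳ-+ b (fromℕ D) (fromℕ (k ℕ.* k)) ⟩
  fromℕ D * b + fromℕ (k ℕ.* k) * b                     ≡⟨ cong (_+ fromℕ (k ℕ.* k) * b) (binomRatio-cross (N ℕ.* N) n k D N k (binomRatio-upper-ℕ n k k≤N)) ⟨
  fromℕ (N ℕ.* N) * binomRatio n k + fromℕ (k ℕ.* k) * b  ∎)
  where
  N = suc n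
  D = (N ℕ.∸ k) ℕ.* (N ℕ.+ k)
  b = binomRatio N k

binomRatio-gap : ℕ → ℕ → ℚ
binomRatio-gap N k = fromℕ (N ℕ.∸ k) * binomRatio N k

binomRatio-gap-step : ∀ N i → i < N →
  binomRatio-gap N i ≡ binomRatio-gap N (suc i) + fromℕ 2 * (fromℕ (suc i) * binomRatio N (suc i))
binomRatio-gap-step N i i<N = begin
  fromℕ (N ℕ.∸ i) * binomRatio N i                 ≡⟨ binomRatio-cross (N ℕ.∸ i) N i (N ℕ.+ j) N j (binomRatio-lower-ℕ N i i<N) ⟩
  fromℕ (N ℕ.+ j) * b                              ≡⟨ cong (λ m → fromℕ m * b) (m+n≡[m∸n]+2*n N j i<N) ⟩
  fromℕ (N ℕ.∸ j ℕ.+ 2 ℕ.* j) * b                  ≡⟨ cong (_* b) (fromℕ-homo-+ (N ℕ.∸ j) (2 ℕ.* j)) ⟩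
  (fromℕ (N ℕ.∸ j) + fromℕ (2 ℕ.* j)) * b          ≡⟨ ℚP.*-distribʳ-+ b (fromℕ (N ℕ.∸ j)) (fromℕ (2 ℕ.* j)) ⟩
  fromℕ (N ℕ.∸ j) * b + fromℕ (2 ℕ.* j) * b        ≡⟨ cong (λ x → fromℕ (N ℕ.∸ j) * b + x * b) (fromℕ-homo-* 2 j) ⟩
  fromℕ (N ℕ.∸ j) * b + fromℕ 2 * fromℕ j * b      ≡⟨ cong (λ x → fromℕ (N ℕ.∸ j) * b + x) (ℚP.*-assoc (fromℕ 2) (fromℕ j) b) ⟩
  fromℕ (N ℕ.∸ j) * b + fromℕ 2 * (fromℕ j * b)    ∎
  where
  j = suc i
  b = binomRatio N j

binomRatio-gap-last : ∀ N → binomRatio-gap N N ≡ 0ℚ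
binomRatio-gap-last N = trans (cong (λ m → fromℕ m * binomRatio N N) (ℕP.n∸n≡0 N)) (ℚP.*-zeroˡ (binomRatio N N))

binomSum : ℕ → (ℕ → ℚ) → ℚ
binomSum n w = sumTo n (λ k → w k * binomRatio n k)

binomSum-cong : ∀ n {v w : ℕ → ℚ} → (∀ {k} → 1 ≤ k → k ≤ n → v k ≡ w k) → binomSum n v ≡ binomSum n w
binomSum-cong n v≡w = sumTo-cong n (λ {k} 1≤k k≤n → cong (_* binomRatio n k) (v≡w 1≤k k≤n))

binomSum-suc : ∀ n w →
  binomSum (suc n) w ≡ binomSum n w + term (+ 2) (suc n) * binomSum (suc n) (λ k → fromℕ (k ℕ.* k) * w k)
binomSum-suc n w = begin
  binomSum N w                                                   ≡⟨ sumTo-cong N (λ _ k≤N → expand k≤N) ⟩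
  sumTo N (λ k → w k * binomRatio n k + t * (s k * b k))         ≡⟨ sumTo-+ N _ _ ⟩
  sumTo N (λ k → w k * binomRatio n k) + sumTo N (λ k → t * (s k * b k))
                                                                 ≡⟨ cong₂ _+_ drop-last (sumTo-* N t _) ⟩
  binomSum n w + t * binomSum N s                                ∎
  where
  N = suc n
  t = term (+ 2) N
  b = binomRatio N
  s : ℕ → ℚ
  s k = fromℕ (k ℕ.* k) * w k
  expand : ∀ {k} → k ≤ N → w k * b k ≡ w k * binomRatio n k + t * (s k * b k)
  expand {k} k≤N = trans (cong (w k *_) (binomRatio-suc n k k≤N))
    (solve 5 (λ w x t q y → w :* (x :+ t :* (q :* y)) := w :* x :+ t :* (q :* w :* y)) refl (w k) (binomRatio n k) t (fromℕ (k ℕ.* k)) (b k))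
  drop-last : binomSum n w + w N * binomRatio n N ≡ binomSum n w
  drop-last = trans (cong (λ x → binomSum n w + w N * x) (binomRatio-beyond n))
    (trans (cong (λ x → binomSum n w + x) (ℚP.*-zeroʳ (w N))) (ℚP.+-identityʳ _))

binomSum-fromℕ : ∀ N → fromℕ 2 * binomSum N fromℕ ≡ fromℕ N
binomSum-fromℕ N = begin
  fromℕ 2 * binomSum N fromℕ          ≡⟨ sumTo-* N (fromℕ 2) (λ j → fromℕ j * binomRatio N j) ⟨
  sumTo N d                           ≡⟨ ℚP.+-identityˡ (sumTo N d) ⟨
  0ℚ + sumTo N d                      ≡⟨ cong (_+ sumTo N d) (binomRatio-gap-last N) ⟨
  binomRatio-gap N N + sumTo N d      ≡⟨ sumTo-telescope N (binomRatio-gap N) d (binomRatio-gap-step N _) ⟨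
  binomRatio-gap N 0                  ≡⟨ ℚP.*-identityʳ (fromℕ N) ⟩
  fromℕ N                             ∎
  where
  d : ℕ → ℚ
  d j = fromℕ 2 * (fromℕ j * binomRatio N j)

binomSum-by-parts : ∀ N c → fromℕ N * binomSum N c ≡
  fromℕ 2 * binomSum N (λ k → fromℕ k * sumTo (k ℕ.∸ 1) c) + binomSum N (λ k → fromℕ k * c k)
binomSum-by-parts N c = begin
  fromℕ N * binomSum N c                                          ≡⟨ sumTo-* N (fromℕ N) (λ k → c k * b k) ⟨
  sumTo N (λ k → fromℕ N * (c k * b k))                           ≡⟨ sumTo-cong N (λ _ k≤N → split k≤N) ⟩
  sumTo N (λ k → c k * gap k + fromℕ k * c k * b k)               ≡⟨ sumTo-+ N _ _ ⟩
  sumTo N (λ k → c k * gap k) + binomSum N (λ k → fromℕ k * c k)  ≡⟨ cong (_+ binomSum N (λ k → fromℕ k * c k)) by-parts ⟩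
  fromℕ 2 * binomSum N (λ k → fromℕ k * sumTo (k ℕ.∸ 1) c) + binomSum N (λ k → fromℕ k * c k) ∎
  where
  b = binomRatio N
  gap = binomRatio-gap N
  d : ℕ → ℚ
  d j = fromℕ 2 * (fromℕ j * b j)
  split : ∀ {k} → k ≤ N → fromℕ N * (c k * b k) ≡ c k * gap k + fromℕ k * c k * b k
  split {k} k≤N = begin
    fromℕ N * (c k * b k)
      ≡⟨ cong (λ m → fromℕ m * (c k * b k)) (ℕP.m∸n+n≡m k≤N) ⟨
    fromℕ (N ℕ.∸ k ℕ.+ k) * (c k * b k)
      ≡⟨ cong (_* (c k * b k)) (fromℕ-homo-+ (N ℕ.∸ k) k) ⟩
    (fromℕ (N ℕ.∸ k) + fromℕ k) * (c k * b k)
      ≡⟨ solve 4 (λ g x y z → (g :+ x) :* (y :* z) := y :* (g :* z) :+ x :* y :* z) refl (fromℕ (N ℕ.∸ k)) (fromℕ k) (c k) (b k) ⟩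
    c k * gap k + fromℕ k * c k * b k
      ∎
  by-parts : sumTo N (λ k → c k * gap k) ≡ fromℕ 2 * binomSum N (λ k → fromℕ k * sumTo (k ℕ.∸ 1) c)
  by-parts = begin
    sumTo N (λ k → c k * gap k)         ≡⟨ sumTo-by-parts N c gap d (binomRatio-gap-step N _) ⟩
    D + sumTo N c * gap N               ≡⟨ cong (λ x → D + sumTo N c * x) (binomRatio-gap-last N) ⟩
    D + sumTo N c * 0ℚ                  ≡⟨ cong (λ x → D + x) (ℚP.*-zeroʳ (sumTo N c)) ⟩
    D + 0ℚ                              ≡⟨ ℚP.+-identityʳ D ⟩
    D                                   ≡⟨ sumTo-cong N (λ {j} _ _ → regroup (fromℕ j) (b j) (sumTo (j ℕ.∸ 1) c)) ⟩
    sumTo N (λ j → fromℕ 2 * (fromℕ j * sumTo (j ℕ.∸ 1) c * b j))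
                                        ≡⟨ sumTo-* N (fromℕ 2) _ ⟩
    fromℕ 2 * binomSum N (λ k → fromℕ k * sumTo (k ℕ.∸ 1) c) ∎
    where
    D = sumTo N (λ j → d j * sumTo (j ℕ.∸ 1) c)
    regroup : ∀ x y z → fromℕ 2 * (x * y) * z ≡ fromℕ 2 * (x * z * y)
    regroup x y z = trans (ℚP.*-assoc (fromℕ 2) (x * y) z) (cong (fromℕ 2 *_) (*-CS.xy∙z≈xz∙y x y z))

sumTo-term-1≡2*binomSum : ∀ n → sumTo n (term (+ 1)) ≡ fromℕ 2 * binomSum n (term (+ 1))
sumTo-term-1≡2*binomSum zero    = sym (ℚP.*-zeroʳ (fromℕ 2))
sumTo-term-1≡2*binomSum (suc n) = begin
  sumTo n u + u N                                   ≡⟨ cong₂ _+_ (sumTo-term-1≡2*binomSum n) (term-1≡term-2*fromℕ n) ⟩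
  two * binomSum n u + t * fromℕ N                  ≡⟨ cong (λ x → two * binomSum n u + t * x) (binomSum-fromℕ N) ⟨
  two * binomSum n u + t * (two * binomSum N fromℕ) ≡⟨ cong (λ x → two * binomSum n u + t * (two * x)) (binomSum-cong N square) ⟩
  two * binomSum n u + t * (two * binomSum N s)     ≡⟨ solve 4 (λ a x t y → a :* x :+ t :* (a :* y) := a :* (x :+ t :* y)) refl two (binomSum n u) t (binomSum N s) ⟩
  two * (binomSum n u + t * binomSum N s)           ≡⟨ cong (two *_) (binomSum-suc n u) ⟨
  two * binomSum N u                                ∎
  where
  N = suc n
  two = fromℕ 2
  t = term (+ 2) N
  u = term (+ 1)
  s : ℕ → ℚ
  s k = fromℕ (k ℕ.* k) * u k
  square : ∀ {k} → 1 ≤ k → k ≤ N → fromℕ k ≡ s k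
  square {suc k} _ _ = sym (fromℕ-square-*-term-1 k)

sumTo-term-1*binomSum : ∀ n c → sumTo n (λ m → term (+ 1) m * binomSum m c) ≡
  fromℕ 2 * binomSum n (λ k → term (+ 1) k * sumTo (k ℕ.∸ 1) c) + binomSum n (λ k → term (+ 1) k * c k)
sumTo-term-1*binomSum zero    c = sym (trans (cong (_+ 0ℚ) (ℚP.*-zeroʳ (fromℕ 2))) (ℚP.+-identityʳ 0ℚ))
sumTo-term-1*binomSum (suc n) c = begin
  sumTo n (λ m → u m * binomSum m c) + u N * binomSum N c
    ≡⟨ cong₂ _+_ (sumTo-term-1*binomSum n c)
         (trans (cong (_* binomSum N c) (term-1≡term-2*fromℕ n)) (ℚP.*-assoc t (fromℕ N) (binomSum N c))) ⟩
  two * R₁ + R₂ + t * (fromℕ N * binomSum N c)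
    ≡⟨ cong (λ x → two * R₁ + R₂ + t * x) (binomSum-by-parts N c) ⟩
  two * R₁ + R₂ + t * (two * binomSum N (λ k → fromℕ k * C k) + binomSum N (λ k → fromℕ k * c k))
    ≡⟨ cong₂ (λ x y → two * R₁ + R₂ + t * (two * x + y)) (binomSum-cong N (square C)) (binomSum-cong N (square c)) ⟩
  two * R₁ + R₂ + t * (two * S₁ + S₂)
    ≡⟨ solve 6 (λ a r₁ r₂ t s₁ s₂ → a :* r₁ :+ r₂ :+ t :* (a :* s₁ :+ s₂) := a :* (r₁ :+ t :* s₁) :+ (r₂ :+ t :* s₂))
         refl two R₁ R₂ t S₁ S₂ ⟩
  two * (R₁ + t * S₁) + (R₂ + t * S₂)
    ≡⟨ cong₂ (λ x y → two * x + y) (binomSum-suc n uC) (binomSum-suc n uc) ⟨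
  two * binomSum N uC + binomSum N uc
    ∎
  where
  N = suc n
  two = fromℕ 2
  t = term (+ 2) N
  u = term (+ 1)
  C uC uc : ℕ → ℚ
  C k = sumTo (k ℕ.∸ 1) c
  uC k = u k * C k
  uc k = u k * c k
  R₁ = binomSum n uC
  R₂ = binomSum n uc
  S₁ = binomSum N (λ k → fromℕ (k ℕ.* k) * uC k)
  S₂ = binomSum N (λ k → fromℕ (k ℕ.* k) * uc k)
  square : ∀ (f : ℕ → ℚ) {k} → 1 ≤ k → k ≤ N → fromℕ k * f k ≡ fromℕ (k ℕ.* k) * (u k * f k)
  square f {suc k} _ _ = sym (trans (sym (ℚP.*-assoc (fromℕ (suc k ℕ.* suc k)) (u (suc k)) (f (suc k))))
    (cong (_* f (suc k)) (fromℕ-square-*-term-1 k)))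

𝓗-binomSum : ∀ n p ps → 𝓗 n (p ∷ ps) ≡ binomSum n (λ k → term p k * H (k ℕ.∸ 1) ps)
𝓗-binomSum n p ps = sumTo-cong n (λ {k} _ _ → *-CS.xy∙z≈xz∙y (term p k) (binomRatio n k) (H (k ℕ.∸ 1) ps))

𝓗-suc : ∀ n h ps →
  𝓗 (suc n) (+[1+ 2 ℕ.+ h ] ∷ ps) ≡ 𝓗 n (+[1+ 2 ℕ.+ h ] ∷ ps) + term (+ 2) (suc n) * 𝓗 (suc n) (+[1+ h ] ∷ ps)
𝓗-suc n h ps = begin
  𝓗 (suc n) (+[1+ 2 ℕ.+ h ] ∷ ps)
    ≡⟨ 𝓗-binomSum (suc n) +[1+ 2 ℕ.+ h ] ps ⟩
  binomSum (suc n) w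
    ≡⟨ binomSum-suc n w ⟩
  binomSum n w + term (+ 2) (suc n) * binomSum (suc n) (λ k → fromℕ (k ℕ.* k) * w k)
    ≡⟨ cong₂ (λ x y → x + term (+ 2) (suc n) * y) (𝓗-binomSum n +[1+ 2 ℕ.+ h ] ps)
         (trans (𝓗-binomSum (suc n) +[1+ h ] ps) (sym (binomSum-cong (suc n) shift))) ⟨
  𝓗 n (+[1+ 2 ℕ.+ h ] ∷ ps) + term (+ 2) (suc n) * 𝓗 (suc n) (+[1+ h ] ∷ ps)
    ∎
  where
  w : ℕ → ℚ
  w k = term +[1+ 2 ℕ.+ h ] k * H (k ℕ.∸ 1) ps
  shift : ∀ {k} → 1 ≤ k → k ≤ suc n → fromℕ (k ℕ.* k) * w k ≡ term +[1+ h ] k * H (k ℕ.∸ 1) ps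
  shift {suc k} _ _ = trans (sym (ℚP.*-assoc (fromℕ (suc k ℕ.* suc k)) _ (H k ps))) (cong (_* H k ps) (term-shift h k))

sumTo-term-1*𝓗 : ∀ n h ps →
  sumTo n (λ m → term (+ 1) m * 𝓗 m (+[1+ h ] ∷ ps)) ≡ fromℕ 2 * 𝓗 n (+ 1 ∷ +[1+ h ] ∷ ps) + 𝓗 n (+[1+ suc h ] ∷ ps)
sumTo-term-1*𝓗 n h ps = begin
  sumTo n (λ m → term (+ 1) m * 𝓗 m (+[1+ h ] ∷ ps))
    ≡⟨ sumTo-cong n (λ {m} _ _ → cong (term (+ 1) m *_) (𝓗-binomSum m +[1+ h ] ps)) ⟩
  sumTo n (λ m → term (+ 1) m * binomSum m c)
    ≡⟨ sumTo-term-1*binomSum n c ⟩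
  fromℕ 2 * binomSum n (λ k → term (+ 1) k * sumTo (k ℕ.∸ 1) c) + binomSum n (λ k → term (+ 1) k * c k)
    ≡⟨ cong₂ (λ x y → fromℕ 2 * x + y) (𝓗-binomSum n (+ 1) (+[1+ h ] ∷ ps))
         (trans (𝓗-binomSum n +[1+ suc h ] ps) (sym (binomSum-cong n merge))) ⟨
  fromℕ 2 * 𝓗 n (+ 1 ∷ +[1+ h ] ∷ ps) + 𝓗 n (+[1+ suc h ] ∷ ps)
    ∎
  where
  c : ℕ → ℚ
  c k = term +[1+ h ] k * H (k ℕ.∸ 1) ps
  merge : ∀ {k} → 1 ≤ k → k ≤ n → term (+ 1) k * c k ≡ term +[1+ suc h ] k * H (k ℕ.∸ 1) ps
  merge {suc k} _ _ = trans (sym (ℚP.*-assoc (term (+ 1) (suc k)) _ (H k ps))) (cong (_* H k ps) (term-* 0 h k))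

-- The index sets Π

⊕-+[1+] : ∀ a h → +[1+ a ] ⊕ +[1+ h ] ≡ +[1+ a ℕ.+ suc h ]
⊕-+[1+] a h = trans (cong₂ ℤ._+_ (ℤP.*-identityˡ +[1+ h ]) (ℤP.*-identityˡ +[1+ a ])) (ℤP.+-comm +[1+ h ] +[1+ a ])

cons⁺ : ℕ × List ℤ → List ℤ
cons⁺ (h , t) = +[1+ h ] ∷ t

split⁺ merge⁺ : ℕ → ℕ × List ℤ → ℕ × List ℤ
split⁺ a q       = a , cons⁺ q
merge⁺ a (h , t) = a ℕ.+ suc h , t

-- Π⁺ a bs lists Π(a+1, b₁+1, …) as (head - 1, tail) pairs, so that heads are positive by
-- construction and ⊕ on them is ordinary addition.
Π⁺ : ℕ → List ℕ → List (ℕ × List ℤ)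
Π⁺ a []       = (a , []) ∷ []
Π⁺ a (b ∷ bs) = map (split⁺ a) (Π⁺ b bs) ++ map (merge⁺ a) (Π⁺ b bs)

Π≡map-cons⁺-Π⁺ : ∀ a bs → Π (+[1+ a ] ∷ map +[1+_] bs) ≡ map cons⁺ (Π⁺ a bs)
Π≡map-cons⁺-Π⁺ a []       = refl
Π≡map-cons⁺-Π⁺ a (b ∷ bs) = begin
  map (+[1+ a ] ∷_) P ++ map (mergeHead +[1+ a ]) P
    ≡⟨ cong (λ P → map (+[1+ a ] ∷_) P ++ map (mergeHead +[1+ a ]) P) (Π≡map-cons⁺-Π⁺ b bs) ⟩
  map (+[1+ a ] ∷_) (map cons⁺ Q) ++ map (mergeHead +[1+ a ]) (map cons⁺ Q)
    ≡⟨ cong₂ _++_ (trans (sym (map-∘ Q)) (map-∘ Q)) (trans (sym (map-∘ Q)) (trans (map-cong merge-cons Q) (map-∘ Q))) ⟨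
  map cons⁺ (map (split⁺ a) Q) ++ map cons⁺ (map (merge⁺ a) Q)
    ≡⟨ map-++ cons⁺ (map (split⁺ a) Q) (map (merge⁺ a) Q) ⟨
  map cons⁺ (Π⁺ a (b ∷ bs))
    ∎
  where
  P = Π (+[1+ b ] ∷ map +[1+_] bs)
  Q = Π⁺ b bs
  merge-cons : ∀ q → cons⁺ (merge⁺ a q) ≡ mergeHead +[1+ a ] (cons⁺ q)
  merge-cons (h , t) = cong (_∷ t) (sym (⊕-+[1+] a h))

Π⁺-shift : ∀ a bs → Π⁺ (2 ℕ.+ a) bs ≡ map (map₁ (2 ℕ.+_)) (Π⁺ a bs)
Π⁺-shift a []       = refl
Π⁺-shift a (b ∷ bs) = sym (trans (map-++ (map₁ (2 ℕ.+_)) (map (split⁺ a) Q) (map (merge⁺ a) Q))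
  (cong₂ _++_ (sym (map-∘ Q)) (sym (map-∘ Q))))
  where Q = Π⁺ b bs

-- Definitionally the summand of rhs, since fromℕ m is (+ m) / 1.
weighted : ℕ → List ℤ → ℚ
weighted n p = fromℕ (2 ℕ.^ length p) * 𝓗 n p

rhs⁺ : ℕ → ℕ → List ℕ → ℚ
rhs⁺ n a bs = sumList (map (weighted n ∘ cons⁺) (Π⁺ a bs))

oddIndex≡map-+[1+] : ∀ as → oddIndex as ≡ map +[1+_] (map (2 ℕ.*_) as)
oddIndex≡map-+[1+] as = trans (map-cong (λ a → cong +_ (ℕP.+-comm (2 ℕ.* a) 1)) as) (map-∘ as)

rhs≡rhs⁺ : ∀ n a as → rhs n (a ∷ as) ≡ rhs⁺ n (2 ℕ.* a) (map (2 ℕ.*_) as)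
rhs≡rhs⁺ n a as = cong sumList (begin
  map (weighted n) (Π (oddIndex (a ∷ as)))                              ≡⟨ cong (map (weighted n) ∘ Π) (oddIndex≡map-+[1+] (a ∷ as)) ⟩
  map (weighted n) (Π (+[1+ 2 ℕ.* a ] ∷ map +[1+_] (map (2 ℕ.*_) as))) ≡⟨ cong (map (weighted n)) (Π≡map-cons⁺-Π⁺ (2 ℕ.* a) (map (2 ℕ.*_) as)) ⟩
  map (weighted n) (map cons⁺ (Π⁺ (2 ℕ.* a) (map (2 ℕ.*_) as)))        ≡⟨ map-∘ _ ⟨
  map (weighted n ∘ cons⁺) (Π⁺ (2 ℕ.* a) (map (2 ℕ.*_) as))            ∎)

rhs⁺-zero : ∀ a bs → rhs⁺ 0 a bs ≡ 0ℚ
rhs⁺-zero a bs = sumList-map-zero (weighted 0 ∘ cons⁺) (Π⁺ a bs) (λ q → ℚP.*-zeroʳ (fromℕ (2 ℕ.^ length (cons⁺ q))))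

weighted-suc : ∀ n h ps → weighted (suc n) (+[1+ 2 ℕ.+ h ] ∷ ps) ≡
  weighted n (+[1+ 2 ℕ.+ h ] ∷ ps) + term (+ 2) (suc n) * weighted (suc n) (+[1+ h ] ∷ ps)
weighted-suc n h ps = trans (cong (w *_) (𝓗-suc n h ps))
  (solve 4 (λ w x t y → w :* (x :+ t :* y) := w :* x :+ t :* (w :* y)) refl w (𝓗 n (+[1+ 2 ℕ.+ h ] ∷ ps)) (term (+ 2) (suc n)) (𝓗 (suc n) (+[1+ h ] ∷ ps)))
  where w = fromℕ (2 ℕ.^ length (+[1+ h ] ∷ ps))

sumTo-term-1*weighted : ∀ n h ps → sumTo n (λ m → term (+ 1) m * weighted m (+[1+ h ] ∷ ps)) ≡
  weighted n (+ 1 ∷ +[1+ h ] ∷ ps) + weighted n (+[1+ suc h ] ∷ ps)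
sumTo-term-1*weighted n h ps = begin
  sumTo n (λ m → term (+ 1) m * (w * 𝓗 m (+[1+ h ] ∷ ps)))
    ≡⟨ sumTo-cong n (λ {m} _ _ → *-CS.x∙yz≈y∙xz (term (+ 1) m) w (𝓗 m (+[1+ h ] ∷ ps))) ⟩
  sumTo n (λ m → w * (term (+ 1) m * 𝓗 m (+[1+ h ] ∷ ps)))
    ≡⟨ sumTo-* n w (λ m → term (+ 1) m * 𝓗 m (+[1+ h ] ∷ ps)) ⟩
  w * sumTo n (λ m → term (+ 1) m * 𝓗 m (+[1+ h ] ∷ ps))
    ≡⟨ cong (w *_) (sumTo-term-1*𝓗 n h ps) ⟩
  w * (fromℕ 2 * X + Y)
    ≡⟨ solve 4 (λ w a x y → w :* (a :* x :+ y) := a :* w :* x :+ w :* y) refl w (fromℕ 2) X Y ⟩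
  fromℕ 2 * w * X + w * Y
    ≡⟨ cong (λ z → z * X + w * Y) (fromℕ-homo-* 2 (2 ℕ.^ length (+[1+ h ] ∷ ps))) ⟨
  fromℕ (2 ℕ.* 2 ℕ.^ length (+[1+ h ] ∷ ps)) * X + w * Y
    ∎
  where
  w = fromℕ (2 ℕ.^ length (+[1+ h ] ∷ ps))
  X = 𝓗 n (+ 1 ∷ +[1+ h ] ∷ ps)
  Y = 𝓗 n (+[1+ suc h ] ∷ ps)

rhs⁺-suc : ∀ n a bs → rhs⁺ (suc n) (2 ℕ.+ a) bs ≡ rhs⁺ n (2 ℕ.+ a) bs + term (+ 2) (suc n) * rhs⁺ (suc n) a bs
rhs⁺-suc n a bs = begin
  rhs⁺ (suc n) (2 ℕ.+ a) bs
    ≡⟨ cong (sumList ∘ map (weighted (suc n) ∘ cons⁺)) (Π⁺-shift a bs) ⟩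
  sumList (map (weighted (suc n) ∘ cons⁺) (map shift Q))
    ≡⟨ cong sumList (trans (sym (map-∘ Q)) (map-cong (λ { (h , ps) → weighted-suc n h ps }) Q)) ⟩
  sumList (map (λ q → weighted n (cons⁺ (shift q)) + t * weighted (suc n) (cons⁺ q)) Q)
    ≡⟨ sumList-map-+ (weighted n ∘ cons⁺ ∘ shift) (λ q → t * weighted (suc n) (cons⁺ q)) Q ⟩
  sumList (map (weighted n ∘ cons⁺ ∘ shift) Q) + sumList (map (λ q → t * weighted (suc n) (cons⁺ q)) Q)
    ≡⟨ cong₂ _+_ (cong sumList (trans (map-∘ Q) (cong (map (weighted n ∘ cons⁺)) (sym (Π⁺-shift a bs)))))
         (sumList-map-* t (weighted (suc n) ∘ cons⁺) Q) ⟩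
  rhs⁺ n (2 ℕ.+ a) bs + t * rhs⁺ (suc n) a bs
    ∎
  where
  Q = Π⁺ a bs
  t = term (+ 2) (suc n)
  shift = map₁ (2 ℕ.+_)

sumTo-term-1*rhs⁺ : ∀ n b bs → sumTo n (λ m → term (+ 1) m * rhs⁺ m b bs) ≡ rhs⁺ n 0 (b ∷ bs)
sumTo-term-1*rhs⁺ n b bs = begin
  sumTo n (λ m → term (+ 1) m * rhs⁺ m b bs)
    ≡⟨ sumTo-cong n (λ {m} _ _ → sumList-map-* (term (+ 1) m) (weighted m ∘ cons⁺) Q) ⟨
  sumTo n (λ m → sumList (map (λ q → term (+ 1) m * weighted m (cons⁺ q)) Q))
    ≡⟨ sumTo-sumList n (λ m q → term (+ 1) m * weighted m (cons⁺ q)) Q ⟩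
  sumList (map (λ q → sumTo n (λ m → term (+ 1) m * weighted m (cons⁺ q))) Q)
    ≡⟨ cong sumList (map-cong (λ { (h , ps) → sumTo-term-1*weighted n h ps }) Q) ⟩
  sumList (map (λ q → f (split⁺ 0 q) + f (merge⁺ 0 q)) Q)
    ≡⟨ sumList-map-+ (f ∘ split⁺ 0) (f ∘ merge⁺ 0) Q ⟩
  sumList (map (f ∘ split⁺ 0) Q) + sumList (map (f ∘ merge⁺ 0) Q)
    ≡⟨ cong₂ _+_ (cong sumList (map-∘ Q)) (cong sumList (map-∘ Q)) ⟩
  sumList (map f (map (split⁺ 0) Q)) + sumList (map f (map (merge⁺ 0) Q))
    ≡⟨ trans (cong sumList (map-++ f (map (split⁺ 0) Q) (map (merge⁺ 0) Q)))
         (sumList-++ (map f (map (split⁺ 0) Q)) (map f (map (merge⁺ 0) Q))) ⟨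
  rhs⁺ n 0 (b ∷ bs)
    ∎
  where
  Q = Π⁺ b bs
  f = weighted n ∘ cons⁺

-- Induction on the blocks of s

H⋆-[1]≡rhs⁺ : ∀ n → H⋆ n (+ 1 ∷ []) ≡ rhs⁺ n 0 []
H⋆-[1]≡rhs⁺ n = begin
  sumTo n (λ k → term (+ 1) k * 1ℚ)
    ≡⟨ sumTo-cong n (λ {k} _ _ → ℚP.*-identityʳ (term (+ 1) k)) ⟩
  sumTo n (term (+ 1))
    ≡⟨ sumTo-term-1≡2*binomSum n ⟩
  fromℕ 2 * binomSum n (term (+ 1))
    ≡⟨ cong (fromℕ 2 *_) (trans (𝓗-binomSum n (+ 1) []) (binomSum-cong n (λ {k} _ _ → ℚP.*-identityʳ (term (+ 1) k)))) ⟨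
  fromℕ 2 * 𝓗 n (+ 1 ∷ [])
    ≡⟨ ℚP.+-identityʳ _ ⟨
  rhs⁺ n 0 []
    ∎

H⋆-sIndex≡rhs⁺ : ∀ as a n → H⋆ n (sIndex (a ∷ as)) ≡ rhs⁺ n (2 ℕ.* a) (map (2 ℕ.*_) as)
H⋆-sIndex≡rhs⁺ as       (suc a) zero    = sym (rhs⁺-zero (2 ℕ.* suc a) (map (2 ℕ.*_) as))
H⋆-sIndex≡rhs⁺ as       (suc a) (suc n) = begin
  H⋆ n (sIndex (suc a ∷ as)) + t * H⋆ (suc n) (sIndex (a ∷ as))
    ≡⟨ cong₂ (λ x y → x + t * y) (H⋆-sIndex≡rhs⁺ as (suc a) n) (H⋆-sIndex≡rhs⁺ as a (suc n)) ⟩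
  rhs⁺ n (2 ℕ.* suc a) bs + t * rhs⁺ (suc n) (2 ℕ.* a) bs
    ≡⟨ cong (λ c → rhs⁺ n c bs + t * rhs⁺ (suc n) (2 ℕ.* a) bs) (ℕP.*-suc 2 a) ⟩
  rhs⁺ n (2 ℕ.+ 2 ℕ.* a) bs + t * rhs⁺ (suc n) (2 ℕ.* a) bs
    ≡⟨ rhs⁺-suc n (2 ℕ.* a) bs ⟨
  rhs⁺ (suc n) (2 ℕ.+ 2 ℕ.* a) bs
    ≡⟨ cong (λ c → rhs⁺ (suc n) c bs) (ℕP.*-suc 2 a) ⟨
  rhs⁺ (suc n) (2 ℕ.* suc a) bs
    ∎
  where
  t = term (+ 2) (suc n)
  bs = map (2 ℕ.*_) as
H⋆-sIndex≡rhs⁺ []       zero    n = H⋆-[1]≡rhs⁺ n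
H⋆-sIndex≡rhs⁺ (b ∷ bs) zero    n = trans
  (sumTo-cong n (λ {m} _ _ → cong (term (+ 1) m *_) (H⋆-sIndex≡rhs⁺ bs b m)))
  (sumTo-term-1*rhs⁺ n (2 ℕ.* b) (map (2 ℕ.*_) bs))

-- The identity also holds for a₁ = 0 and for n = 0.
theorem2p1 : (a₁ : ℕ) → 1 ≤ a₁ → (as : List ℕ) → (n : ℕ) → 1 ≤ n →
    H⋆ n (sIndex (a₁ ∷ as)) ≡ rhs n (a₁ ∷ as)
theorem2p1 a₁ _ as n _ = trans (H⋆-sIndex≡rhs⁺ as a₁ n) (sym (rhs≡rhs⁺ n a₁ as))
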